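{- If $G_1$ and $G_2$ are connected strongly regular graphs with the same parameters $(n,d,\lambda,\mu)$, then $\mathfrak{s}^1_{G_1}=\mathfrak{s}^1_{G_2}$.
   Context: Graphs are finite, simple, undirected. A $d$-regular graph on $n$ nodes is strongly regular with parameters $(n,d,\lambda,\mu)$ if every two adjacent nodes have exactly $\lambda$ common neighbours and every two non-adjacent nodes have exactly $\mu$ common neighbours. For a node $i_1$ of $G=(V,E)$ define labels $L_l(i)$, $i\in V$, $l\ge0$: $L_0(i)=(\emptyset,\{1\})$ if $i=i_1$ and $L_0(i)=(\emptyset,\{0\})$ otherwise; for $l\ge1$, $L_l(i)=(L_{l-1}(i),\{L_{l-1}(i'):i'\in N_G(i)\}^\#)$, where $N_G(i)$ is the neighbour set and $\{\dots\}^\#$ a multiset; labels are compared by structural equality across graphs. $\mathfrak{s}^1_G(i_1)$ is the matrix with rows indexed by $V$, columns by $l\ge0$, and $(i,l)$ entry $L_l(i)$, taken up to permutation of rows; $\mathfrak{s}^1_G=\{\mathfrak{s}^1_G(i_1):i_1\in V\}^\#$. -}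

module Defs where

open import Data.Nat using (ℕ; zero; suc)
open import Data.Bool using (Bool; true; false; _∧_; T?)
open import Data.Fin using (Fin; _≟_)
open import Data.List using (List; map; filter; length)
open import Data.List.Base using ()
open import Data.Fin.Base using ()
open import Data.List.Relation.Binary.Permutation.Homogeneous using (Permutation)
open import Data.Product using (Σ; ∃; _×_; _,_)
open import Function.Bundles using (_⤖_; Bijection)
open import Relation.Binary.PropositionalEquality using (_≡_)
open import Relation.Nullary using (¬_)
open import Relation.Nullary.Decidable using (⌊_⌋)
open import Data.Vec.Functional using ()
import Data.List as L

allNodes : (n : ℕ) → List (Fin n)
allNodes n = L.allFin n

record Graph : Set where
  field
    size   : ℕ
    adj    : Fin size → Fin size → Bool
    adj-sym    : ∀ i j → adj i j ≡ adj j i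
    adj-irrefl : ∀ i → adj i i ≡ false

open Graph public

nbrs : (G : Graph) → Fin (size G) → List (Fin (size G))
nbrs G i = filter (λ j → T? (adj G i j))
                  (allNodes (size G))

degree : (G : Graph) → Fin (size G) → ℕ
degree G i = length (nbrs G i)

common : (G : Graph) → Fin (size G) → Fin (size G) → ℕ
common G i j = length (filter (λ k → T? (adj G i k ∧ adj G j k))
                              (allNodes (size G)))

data Reachable (G : Graph) : Fin (size G) → Fin (size G) → Set where
  here : ∀ {i} → Reachable G i i
  step : ∀ {i j k} → adj G i j ≡ true → Reachable G j k → Reachable G i k

Connected : Graph → Set
Connected G = ∀ i j → Reachable G i j

IsSRG : Graph → ℕ → ℕ → ℕ → ℕ → Set
IsSRG G n d l m =
  size G ≡ n ×
  (∀ i → degree G i ≡ d) ×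
  (∀ i j → adj G i j ≡ true → common G i j ≡ l) ×
  (∀ i j → ¬ (i ≡ j) → adj G i j ≡ false → common G i j ≡ m)

-- Labels: base b  stands for (∅, {b}) with b ∈ {0,1} (true = 1);
-- node a xs stands for (a, {xs}^#) with xs a multiset given as a list.
data Label : Set where
  base : Bool → Label
  node : Label → List Label → Label

data _≈L_ : Label → Label → Set where
  base-eq : ∀ {b} → base b ≈L base b
  node-eq : ∀ {a b xs ys} → a ≈L b → Permutation _≈L_ xs ys → node a xs ≈L node b ys

Lab : (G : Graph) → Fin (size G) → ℕ → Fin (size G) → Label
Lab G i₁ zero    i = base ⌊ i ≟ i₁ ⌋
Lab G i₁ (suc l) i = node (Lab G i₁ l i) (map (Lab G i₁ l) (nbrs G i))

-- 𝔰¹_{G₁}(i₁) = 𝔰¹_{G₂}(i₂): the matrices agree up to a permutation of rows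
SameS1At : (G₁ : Graph) → Fin (size G₁) → (G₂ : Graph) → Fin (size G₂) → Set
SameS1At G₁ i₁ G₂ i₂ =
  Σ (Fin (size G₁) ⤖ Fin (size G₂)) λ π →
    ∀ (i : Fin (size G₁)) (l : ℕ) →
      Lab G₁ i₁ l i ≈L Lab G₂ i₂ l (Bijection.to π i)

-- 𝔰¹_{G₁} = 𝔰¹_{G₂} as multisets (matched by a bijection of the roots)
SameS1 : Graph → Graph → Set
SameS1 G₁ G₂ =
  Σ (Fin (size G₁) ⤖ Fin (size G₂)) λ ρ →
    ∀ (i₁ : Fin (size G₁)) → SameS1At G₁ i₁ G₂ (Bijection.to ρ i₁)

{-# OPTIONS --safe #-}
module Submission where

-- Fix a root r. Every node is r, a neighbour of r, or a non-neighbour of r, and strong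
-- regularity says how many nodes of each of these three roles are adjacent to a node of a
-- given role: (0, d, 0), (1, λ, d-1-λ) and (0, μ, d-μ). Hence, by induction on l, the label
-- L_l(i) is, up to ≈L, a canonical label depending only on l, the parameters and the role
-- of i. Both graphs have one root, d neighbours and n-1-d other nodes, so a role-preserving
-- bijection of the nodes identifies the two matrices, whichever roots are paired.

open import Defs
open import Data.Bool using (Bool; true; false; _∧_; if_then_else_; T?)
open import Data.Bool.Properties using (∧-idem; ∧-identityʳ; ∧-zeroʳ)
open import Data.Fin using (Fin; zero; suc; _≟_)
open import Data.Fin.Properties using (suc-injective)
open import Data.List using (List; []; _∷_; _++_; map; filter; length; replicate; tabulate; allFin)
open import Data.List.Properties using (++-assoc; map-∘; length-map; length-tabulate)
open import Data.List.Relation.Binary.BagAndSetEquality using (↭⇒∼bag)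
open import Data.List.Relation.Binary.Permutation.Propositional
  using (_↭_; ↭-refl; ↭-sym; ↭-trans; ↭-reflexive; ↭-prep; ↭⇒↭ₛ′; module PermutationReasoning)
open import Data.List.Relation.Binary.Permutation.Propositional.Properties using (shift; map⁺)
import Data.List.Relation.Binary.Permutation.Homogeneous as Perm
open import Data.List.Relation.Binary.Pointwise using (Pointwise; []; _∷_)
open import Data.List.Relation.Unary.Any using (Any; here; there)
open import Data.List.Relation.Unary.Any.Properties using (tabulate⁺; tabulate⁻)
open import Data.Nat using (ℕ; zero; suc; _+_; _∸_)
open import Data.Nat.Properties using (+-suc; m+n∸m≡n)
open import Data.Product using (Σ; ∃; _,_; proj₁; proj₂; uncurry)
import Data.Product as Product
open import Function using (_∘_; id)
open import Function.Bundles using (_↔_; _⤖_; Inverse; Bijection; mk↔ₛ′)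
open import Function.Construct.Identity using (⤖-id)
open import Function.Properties.Inverse using (↔-sym; ↔-trans; ↔⇒⤖)
open import Relation.Binary.Bundles using (Setoid)
import Relation.Binary.Reasoning.Setoid as SetoidReasoning
open import Relation.Binary.Definitions using (Reflexive; Symmetric; Transitive)
open import Relation.Binary.Structures using (IsEquivalence)
open import Relation.Binary.PropositionalEquality
  using (_≡_; _≢_; refl; sym; trans; cong; subst; _≗_; module ≡-Reasoning)
open import Relation.Nullary using (yes; no)
open import Relation.Nullary.Decidable using (⌊_⌋; ⌊⌋-map′)

count : {A : Set} → (A → Bool) → List A → ℕ
count p []       = 0
count p (x ∷ xs) = if p x then suc (count p xs) else count p xs

module _ {A : Set} where

  length-filter-T? : (p : A → Bool) (xs : List A) →
                     length (filter (λ x → T? (p x)) xs) ≡ count p xs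
  length-filter-T? p []       = refl
  length-filter-T? p (x ∷ xs) with p x
  ... | true  = cong suc (length-filter-T? p xs)
  ... | false = length-filter-T? p xs

  count-map : {B : Set} (p : B → Bool) (f : A → B) (xs : List A) →
              count p (map f xs) ≡ count (p ∘ f) xs
  count-map p f []       = refl
  count-map p f (x ∷ xs) with p (f x)
  ... | true  = cong suc (count-map p f xs)
  ... | false = count-map p f xs

  count-filter : (p q : A → Bool) (xs : List A) →
                 count p (filter (λ x → T? (q x)) xs) ≡ count (λ x → q x ∧ p x) xs
  count-filter p q []       = refl
  count-filter p q (x ∷ xs) with q x
  ... | false = count-filter p q xs
  ... | true with p x
  ...   | true  = cong suc (count-filter p q xs)
  ...   | false = count-filter p q xs

  count-cong : {p q : A → Bool} → p ≗ q → (xs : List A) → count p xs ≡ count q xs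
  count-cong p≗q []       = refl
  count-cong p≗q (x ∷ xs) rewrite p≗q x = cong (λ c → if _ then suc c else c) (count-cong p≗q xs)

count-tabulate : {A : Set} (p : A → Bool) {n : ℕ} (f : Fin n → A) →
                 count p (tabulate f) ≡ count (p ∘ f) (allFin n)
count-tabulate p {zero}  f = refl
count-tabulate p {suc n} f with p (f zero)
... | true  = cong suc (trans (count-tabulate p (f ∘ suc)) (sym (count-tabulate (p ∘ f) suc)))
... | false = trans (count-tabulate p (f ∘ suc)) (sym (count-tabulate (p ∘ f) suc))

count-none : {A : Set} {p : A → Bool} → (∀ x → p x ≡ false) → (xs : List A) → count p xs ≡ 0
count-none p≡false []       = refl
count-none p≡false (x ∷ xs) rewrite p≡false x = count-none p≡false xs

count-∧-≟ : ∀ {n} (p : Fin n → Bool) (r : Fin n) →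
            count (λ k → p k ∧ ⌊ k ≟ r ⌋) (allFin n) ≡ (if p r then 1 else 0)
count-∧-≟ {suc n} p zero rewrite ∧-identityʳ (p zero) =
  cong (λ c → if p zero then suc c else c)
       (trans (count-tabulate (λ k → p k ∧ ⌊ k ≟ zero ⌋) {n} suc)
              (count-none (λ k → ∧-zeroʳ (p (suc k))) (allFin n)))
-- ⌊ suc k ≟ suc r ⌋ is not definitionally ⌊ k ≟ r ⌋: ⌊_⌋ does not compute through map′.
count-∧-≟ {suc n} p (suc r) rewrite ∧-zeroʳ (p zero) =
  begin
    count (λ k → p k ∧ ⌊ k ≟ suc r ⌋) (tabulate suc)
      ≡⟨ count-tabulate (λ k → p k ∧ ⌊ k ≟ suc r ⌋) {n} suc ⟩
    count (λ k → p (suc k) ∧ ⌊ suc k ≟ suc r ⌋) (allFin n)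
      ≡⟨ count-cong (λ k → cong (p (suc k) ∧_) (⌊⌋-map′ (cong suc) suc-injective (k ≟ r))) (allFin n) ⟩
    count (λ k → p (suc k) ∧ ⌊ k ≟ r ⌋) (allFin n)
      ≡⟨ count-∧-≟ (λ k → p (suc k)) r ⟩
    (if p (suc r) then 1 else 0) ∎
  where open ≡-Reasoning

data Role : Set where
  root neighbour distant : Role

isRoot isNeighbour isDistant : Role → Bool
isRoot root = true
isRoot _    = false
isNeighbour neighbour = true
isNeighbour _         = false
isDistant distant = true
isDistant _       = false

rolesOf : ℕ → ℕ → ℕ → List Role
rolesOf a b c = replicate a root ++ replicate b neighbour ++ replicate c distant

↭-rolesOf-counts : (ws : List Role) →
  ws ↭ rolesOf (count isRoot ws) (count isNeighbour ws) (count isDistant ws)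
↭-rolesOf-counts [] = ↭-refl
↭-rolesOf-counts (root ∷ ws) = ↭-prep root (↭-rolesOf-counts ws)
↭-rolesOf-counts (neighbour ∷ ws) = begin
  neighbour ∷ ws               ↭⟨ ↭-prep neighbour (↭-rolesOf-counts ws) ⟩
  neighbour ∷ R ++ N ++ D      ↭⟨ shift neighbour R (N ++ D) ⟨
  R ++ neighbour ∷ N ++ D      ∎
  where
  open PermutationReasoning
  R = replicate (count isRoot ws) root
  N = replicate (count isNeighbour ws) neighbour
  D = replicate (count isDistant ws) distant
↭-rolesOf-counts (distant ∷ ws) = begin
  distant ∷ ws                 ↭⟨ ↭-prep distant (↭-rolesOf-counts ws) ⟩
  distant ∷ R ++ N ++ D        ≡⟨ cong (distant ∷_) (++-assoc R N D) ⟨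
  distant ∷ (R ++ N) ++ D      ↭⟨ shift distant (R ++ N) D ⟨
  (R ++ N) ++ distant ∷ D      ≡⟨ ++-assoc R N (distant ∷ D) ⟩
  R ++ N ++ distant ∷ D        ∎
  where
  open PermutationReasoning
  R = replicate (count isRoot ws) root
  N = replicate (count isNeighbour ws) neighbour
  D = replicate (count isDistant ws) distant

length≡counts : (ws : List Role) →
  length ws ≡ count isRoot ws + count isNeighbour ws + count isDistant ws
length≡counts [] = refl
length≡counts (root ∷ ws) = cong suc (length≡counts ws)
length≡counts (neighbour ∷ ws) =
  trans (cong suc (length≡counts ws)) (cong (_+ count isDistant ws) (sym (+-suc _ _)))
length≡counts (distant ∷ ws) = trans (cong suc (length≡counts ws)) (sym (+-suc _ _))

↭-rolesOf : ∀ {ws a b len} → count isRoot ws ≡ a → count isNeighbour ws ≡ b → length ws ≡ len →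
            ws ↭ rolesOf a b (len ∸ (a + b))
↭-rolesOf {ws} refl refl refl =
  subst (λ c → ws ↭ rolesOf (count isRoot ws) (count isNeighbour ws) c) distants (↭-rolesOf-counts ws)
  where
  distants : count isDistant ws ≡ length ws ∸ (count isRoot ws + count isNeighbour ws)
  distants = sym (trans (cong (_∸ (count isRoot ws + count isNeighbour ws)) (length≡counts ws))
                        (m+n∸m≡n (count isRoot ws + count isNeighbour ws) (count isDistant ws)))

mutual
  ≈L-refl : Reflexive _≈L_
  ≈L-refl {base b}    = base-eq
  ≈L-refl {node a xs} = node-eq ≈L-refl (Perm.refl ≋L-refl)

  ≋L-refl : Reflexive (Pointwise _≈L_)
  ≋L-refl {[]}     = []
  ≋L-refl {x ∷ xs} = ≈L-refl ∷ ≋L-refl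

mutual
  ≈L-sym : Symmetric _≈L_
  ≈L-sym base-eq             = base-eq
  ≈L-sym (node-eq a≈b xs↭ys) = node-eq (≈L-sym a≈b) (↭L-sym xs↭ys)

  ↭L-sym : Symmetric (Perm.Permutation _≈L_)
  ↭L-sym (Perm.refl xs≋ys)         = Perm.refl (≋L-sym xs≋ys)
  ↭L-sym (Perm.prep x≈y xs↭ys)     = Perm.prep (≈L-sym x≈y) (↭L-sym xs↭ys)
  ↭L-sym (Perm.swap x≈x′ y≈y′ xs↭ys) = Perm.swap (≈L-sym y≈y′) (≈L-sym x≈x′) (↭L-sym xs↭ys)
  ↭L-sym (Perm.trans xs↭ys ys↭zs)  = Perm.trans (↭L-sym ys↭zs) (↭L-sym xs↭ys)

  ≋L-sym : Symmetric (Pointwise _≈L_)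
  ≋L-sym []               = []
  ≋L-sym (x≈y ∷ xs≋ys) = ≈L-sym x≈y ∷ ≋L-sym xs≋ys

≈L-trans : Transitive _≈L_
≈L-trans base-eq               base-eq               = base-eq
≈L-trans (node-eq a≈b xs↭ys) (node-eq b≈c ys↭zs) = node-eq (≈L-trans a≈b b≈c) (Perm.trans xs↭ys ys↭zs)

≈L-isEquivalence : IsEquivalence _≈L_
≈L-isEquivalence = record { refl = ≈L-refl ; sym = ≈L-sym ; trans = ≈L-trans }

≈L-setoid : Setoid _ _
≈L-setoid = record { isEquivalence = ≈L-isEquivalence }

pointwise-map : {A B : Set} {R : B → B → Set} {f g : A → B} →
                (∀ x → R (f x) (g x)) → (xs : List A) → Pointwise R (map f xs) (map g xs)
pointwise-map Rfg []       = []
pointwise-map Rfg (x ∷ xs) = Rfg x ∷ pointwise-map Rfg xs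

module _ {A : Set} {P : A → Set} where

  tabulate⁺∘tabulate⁻ : ∀ {n} {f : Fin n → A} (p : Any P (tabulate f)) →
                        uncurry (tabulate⁺ {P = P}) (tabulate⁻ p) ≡ p
  tabulate⁺∘tabulate⁻ {suc n} (here p)  = refl
  tabulate⁺∘tabulate⁻ {suc n} (there p) = cong there (tabulate⁺∘tabulate⁻ p)

  tabulate⁻∘tabulate⁺ : ∀ {n} {f : Fin n → A} (p : ∃ λ i → P (f i)) →
                        tabulate⁻ {P = P} {f = f} (uncurry (tabulate⁺ {P = P}) p) ≡ p
  tabulate⁻∘tabulate⁺ (zero  , p) = refl
  tabulate⁻∘tabulate⁺ (suc i , p) = cong (Product.map suc id) (tabulate⁻∘tabulate⁺ (i , p))

  tabulate↔ : ∀ {n} {f : Fin n → A} → (∃ λ i → P (f i)) ↔ Any P (tabulate f)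
  tabulate↔ = mk↔ₛ′ (uncurry (tabulate⁺ {P = P})) tabulate⁻ tabulate⁺∘tabulate⁻ tabulate⁻∘tabulate⁺

module _ {A : Set} where

  _≅fibres_ : {I J : Set} → (I → A) → (J → A) → Set
  f ≅fibres g = ∀ {x} → (∃ λ i → x ≡ f i) ↔ (∃ λ j → x ≡ g j)

  ≅fibres-sym : {I J : Set} {f : I → A} {g : J → A} → f ≅fibres g → g ≅fibres f
  ≅fibres-sym φ = ↔-sym φ

  reindex : {I J : Set} {f : I → A} {g : J → A} → f ≅fibres g → I → J
  reindex φ i = proj₁ (Inverse.to φ (i , refl))

  reindex-preserves : {I J : Set} {f : I → A} {g : J → A} (φ : f ≅fibres g) → ∀ i → g (reindex φ i) ≡ f i
  reindex-preserves φ i = sym (proj₂ (Inverse.to φ (i , refl)))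

  reindex-inverse : {I J : Set} {f : I → A} {g : J → A} (φ : f ≅fibres g) →
                    ∀ i → reindex (≅fibres-sym φ) (reindex φ i) ≡ i
  reindex-inverse {g = g} φ i = begin
    proj₁ (Inverse.from φ (proj₁ p , refl))   ≡⟨ index-irrelevant (proj₁ p) (proj₂ p) ⟨
    proj₁ (Inverse.from φ p)                  ≡⟨ cong proj₁ (Inverse.strictlyInverseʳ φ (i , refl)) ⟩
    i                                         ∎
    where
    open ≡-Reasoning
    p = Inverse.to φ (i , refl)
    index-irrelevant : ∀ {x} j (e : x ≡ g j) →
                       proj₁ (Inverse.from φ (j , e)) ≡ proj₁ (Inverse.from φ (j , refl))
    index-irrelevant j refl = refl

  ≅fibres⇒⤖ : {I J : Set} {f : I → A} {g : J → A} →
             f ≅fibres g → Σ (I ⤖ J) λ π → ∀ i → g (Bijection.to π i) ≡ f i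
  ≅fibres⇒⤖ φ = ↔⇒⤖ (mk↔ₛ′ (reindex φ) (reindex φ⁻¹) (reindex-inverse φ⁻¹) (reindex-inverse φ))
              , reindex-preserves φ
    where φ⁻¹ = ≅fibres-sym φ

↭-tabulate⇒⤖ : ∀ {A : Set} {m n} {f : Fin m → A} {g : Fin n → A} →
               tabulate f ↭ tabulate g → Σ (Fin m ⤖ Fin n) λ π → ∀ i → g (Bijection.to π i) ≡ f i
↭-tabulate⇒⤖ σ = ≅fibres⇒⤖ (↔-trans tabulate↔ (↔-trans (↭⇒∼bag σ) (↔-sym tabulate↔)))

common-self : (G : Graph) (i : Fin (size G)) → common G i i ≡ degree G i
common-self G i = begin
  common G i i                                    ≡⟨ length-filter-T? (λ k → adj G i k ∧ adj G i k) all ⟩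
  count (λ k → adj G i k ∧ adj G i k) all         ≡⟨ count-cong (λ k → ∧-idem (adj G i k)) all ⟩
  count (adj G i) all                             ≡⟨ length-filter-T? (adj G i) all ⟨
  degree G i                                      ∎
  where
  open ≡-Reasoning
  all = allFin (size G)

roleOf : Bool → Bool → Role
roleOf true  _     = root
roleOf false true  = neighbour
roleOf false false = distant

module Rooted (G : Graph) (r : Fin (size G)) where

  role : Fin (size G) → Role
  role i = roleOf ⌊ i ≟ r ⌋ (adj G r i)

  data RoleView (i : Fin (size G)) : Role → Set where
    is-root      : i ≡ r → RoleView i root
    is-neighbour : i ≢ r → adj G r i ≡ true → RoleView i neighbour
    is-distant   : i ≢ r → adj G r i ≡ false → RoleView i distant

  role-view : ∀ i → RoleView i (role i)
  role-view i with i ≟ r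
  ... | yes i≡r = is-root i≡r
  ... | no  i≢r with adj G r i in e
  ...   | true  = is-neighbour i≢r e
  ...   | false = is-distant i≢r e

  isRoot-role : ∀ k → isRoot (role k) ≡ ⌊ k ≟ r ⌋
  isRoot-role k with k ≟ r
  ... | yes _ = refl
  ... | no  _ with adj G r k
  ...   | true  = refl
  ...   | false = refl

  isNeighbour-role : ∀ k → isNeighbour (role k) ≡ adj G r k
  isNeighbour-role k with k ≟ r
  ... | yes refl = sym (adj-irrefl G r)
  ... | no  _ with adj G r k
  ...   | true  = refl
  ...   | false = refl

  private
    all = allFin (size G)

  count-roles-nbrs : (q : Role → Bool) (i : Fin (size G)) →
                     count q (map role (nbrs G i)) ≡ count (λ k → adj G i k ∧ q (role k)) all
  count-roles-nbrs q i = trans (count-map q role (nbrs G i)) (count-filter (q ∘ role) (adj G i) all)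

  roots-among-nbrs : ∀ i → count isRoot (map role (nbrs G i)) ≡ (if adj G r i then 1 else 0)
  roots-among-nbrs i = begin
    count isRoot (map role (nbrs G i))         ≡⟨ count-roles-nbrs isRoot i ⟩
    count (λ k → adj G i k ∧ isRoot (role k)) all
      ≡⟨ count-cong (λ k → cong (adj G i k ∧_) (isRoot-role k)) all ⟩
    count (λ k → adj G i k ∧ ⌊ k ≟ r ⌋) all    ≡⟨ count-∧-≟ (adj G i) r ⟩
    (if adj G i r then 1 else 0)               ≡⟨ cong (λ b → if b then 1 else 0) (adj-sym G i r) ⟩
    (if adj G r i then 1 else 0)               ∎
    where open ≡-Reasoning

  neighbours-among-nbrs : ∀ i → count isNeighbour (map role (nbrs G i)) ≡ common G i r
  neighbours-among-nbrs i = begin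
    count isNeighbour (map role (nbrs G i))    ≡⟨ count-roles-nbrs isNeighbour i ⟩
    count (λ k → adj G i k ∧ isNeighbour (role k)) all
      ≡⟨ count-cong (λ k → cong (adj G i k ∧_) (isNeighbour-role k)) all ⟩
    count (λ k → adj G i k ∧ adj G r k) all    ≡⟨ length-filter-T? (λ k → adj G i k ∧ adj G r k) all ⟨
    common G i r                               ∎
    where open ≡-Reasoning

  roots-total : count isRoot (tabulate role) ≡ 1
  roots-total = begin
    count isRoot (tabulate role)               ≡⟨ count-tabulate isRoot role ⟩
    count (isRoot ∘ role) all                  ≡⟨ count-cong isRoot-role all ⟩
    count (λ k → ⌊ k ≟ r ⌋) all                ≡⟨ count-∧-≟ (λ _ → true) r ⟩
    1                                          ∎
    where open ≡-Reasoning

  neighbours-total : count isNeighbour (tabulate role) ≡ degree G r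
  neighbours-total = begin
    count isNeighbour (tabulate role)          ≡⟨ count-tabulate isNeighbour role ⟩
    count (isNeighbour ∘ role) all             ≡⟨ count-cong isNeighbour-role all ⟩
    count (adj G r) all                        ≡⟨ length-filter-T? (adj G r) all ⟨
    degree G r                                 ∎
    where open ≡-Reasoning

module Canonical (d λ′ μ : ℕ) where

  rootsAdjacentTo : Role → ℕ
  rootsAdjacentTo neighbour = 1
  rootsAdjacentTo _         = 0

  neighboursAdjacentTo : Role → ℕ
  neighboursAdjacentTo root      = d
  neighboursAdjacentTo neighbour = λ′
  neighboursAdjacentTo distant   = μ

  nbrRoles : Role → List Role
  nbrRoles c = rolesOf (rootsAdjacentTo c) (neighboursAdjacentTo c)
                       (d ∸ (rootsAdjacentTo c + neighboursAdjacentTo c))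

  canonicalLabel : ℕ → Role → Label
  canonicalLabel zero    c = base (isRoot c)
  canonicalLabel (suc l) c = node (canonicalLabel l c) (map (canonicalLabel l) (nbrRoles c))

module RootedSRG {n d λ′ μ : ℕ} (G : Graph) (S : IsSRG G n d λ′ μ) (r : Fin (size G)) where
  open Rooted G r
  open Canonical d λ′ μ

  private
    size≡n   = proj₁ S
    regular  = proj₁ (proj₂ S)
    λ-common = proj₁ (proj₂ (proj₂ S))
    μ-common = proj₂ (proj₂ (proj₂ S))

  roots-adjacent : ∀ i → (if adj G r i then 1 else 0) ≡ rootsAdjacentTo (role i)
  roots-adjacent i with role i | role-view i
  ... | root      | is-root refl        = cong (λ b → if b then 1 else 0) (adj-irrefl G r)
  ... | neighbour | is-neighbour _ rᵢ   = cong (λ b → if b then 1 else 0) rᵢ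
  ... | distant   | is-distant _ rᵢ     = cong (λ b → if b then 1 else 0) rᵢ

  common-with-root : ∀ i → common G i r ≡ neighboursAdjacentTo (role i)
  common-with-root i with role i | role-view i
  ... | root      | is-root refl        = trans (common-self G r) (regular r)
  ... | neighbour | is-neighbour i≢r rᵢ = λ-common i r (trans (adj-sym G i r) rᵢ)
  ... | distant   | is-distant i≢r rᵢ   = μ-common i r i≢r (trans (adj-sym G i r) rᵢ)

  nbrRoles-↭ : ∀ i → map role (nbrs G i) ↭ nbrRoles (role i)
  nbrRoles-↭ i = ↭-rolesOf (trans (roots-among-nbrs i) (roots-adjacent i))
                           (trans (neighbours-among-nbrs i) (common-with-root i))
                           (trans (length-map role (nbrs G i)) (regular i))

  roles-↭ : tabulate role ↭ rolesOf 1 d (n ∸ (1 + d))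
  roles-↭ = ↭-rolesOf roots-total (trans neighbours-total (regular r))
                      (trans (length-tabulate role) size≡n)

  Lab≈canonicalLabel : ∀ l i → Lab G r l i ≈L canonicalLabel l (role i)
  Lab≈canonicalLabel zero    i = subst (λ b → base ⌊ i ≟ r ⌋ ≈L base b) (sym (isRoot-role i)) base-eq
  Lab≈canonicalLabel (suc l) i = node-eq (Lab≈canonicalLabel l i) (Perm.trans
    (Perm.refl (pointwise-map (Lab≈canonicalLabel l) (nbrs G i)))
    (↭⇒↭ₛ′ ≈L-isEquivalence (↭-trans (↭-reflexive (map-∘ (nbrs G i)))
                                     (map⁺ (canonicalLabel l) (nbrRoles-↭ i)))))

sameS1At : ∀ {n d λ′ μ} {G₁ G₂ : Graph} → IsSRG G₁ n d λ′ μ → IsSRG G₂ n d λ′ μ →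
           ∀ r₁ r₂ → SameS1At G₁ r₁ G₂ r₂
sameS1At {d = d} {λ′} {μ} {G₁} {G₂} S₁ S₂ r₁ r₂ = π , same-labels
  where
  module R₁ = RootedSRG G₁ S₁ r₁
  module R₂ = RootedSRG G₂ S₂ r₂
  open Canonical d λ′ μ

  open Rooted G₁ r₁ using () renaming (role to role₁)
  open Rooted G₂ r₂ using () renaming (role to role₂)

  π-preserves-role : Σ (Fin (size G₁) ⤖ Fin (size G₂)) λ π → ∀ i → role₂ (Bijection.to π i) ≡ role₁ i
  π-preserves-role = ↭-tabulate⇒⤖ (↭-trans R₁.roles-↭ (↭-sym R₂.roles-↭))

  π : Fin (size G₁) ⤖ Fin (size G₂)
  π = proj₁ π-preserves-role

  same-labels : ∀ i l → Lab G₁ r₁ l i ≈L Lab G₂ r₂ l (Bijection.to π i)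
  same-labels i l = begin
    Lab G₁ r₁ l i                                  ≈⟨ R₁.Lab≈canonicalLabel l i ⟩
    canonicalLabel l (role₁ i)                     ≡⟨ cong (canonicalLabel l) (proj₂ π-preserves-role i) ⟨
    canonicalLabel l (role₂ (Bijection.to π i))    ≈⟨ R₂.Lab≈canonicalLabel l (Bijection.to π i) ⟨
    Lab G₂ r₂ l (Bijection.to π i)                 ∎
    where open SetoidReasoning ≈L-setoid

theorem14 : (n d λ' μ : ℕ) (G₁ G₂ : Graph) →
    Connected G₁ → Connected G₂ →
    IsSRG G₁ n d λ' μ → IsSRG G₂ n d λ' μ →
    SameS1 G₁ G₂
theorem14 n d λ' μ G₁ G₂ _ _ S₁ S₂ = ρ , λ r₁ → sameS1At S₁ S₂ r₁ (Bijection.to ρ r₁)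
  where
  ρ : Fin (size G₁) ⤖ Fin (size G₂)
  ρ = subst (λ m → Fin (size G₁) ⤖ Fin m) (trans (proj₁ S₁) (sym (proj₁ S₂))) (⤖-id _)
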